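{- Let $D$ be a digraph with $k$ vertices. For each positive integer $n$ that is a multiple of $k$, there is a tournament $T$ on $n$ vertices with $t_D(T)\ge k^{ -k}$. In particular, if $e(D)>k\log_2 k$, then $t_D(T)\ge k^{ -k}>2^{ -e(D)}$, and hence $D$ is not tournament anti-Sidorenko.
   Context: All digraphs are oriented graphs (no loops, no antiparallel edges). A tournament is an orientation of a complete graph without loops. $t_D(T)=h_D(T)/v(T)^{v(D)}$ where $h_D(T)$ is the number of maps $\phi:V(D)\to V(T)$ with $(\phi(x),\phi(y))\in E(T)$ for every $(x,y)\in E(D)$. $D$ is tournament anti-Sidorenko if $t_D(T)\le2^{ -e(D)}$ for every tournament $T$. -}

module Defs where

open import Data.Nat using (ℕ; zero; suc; _+_; _*_; _^_; _≤_; _<_)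
open import Data.Fin using (Fin; zero; suc)
open import Data.Bool using (Bool; true; false; _∧_; _∨_; not; if_then_else_)
open import Data.List using (List; []; _∷_; [_]; map; concatMap; allFin; filter; length; foldr)
open import Data.Product using (Σ; _×_; _,_)
open import Data.Sum using (_⊎_)
open import Relation.Binary.PropositionalEquality using (_≡_; _≢_)

Rel : ℕ → Set
Rel n = Fin n → Fin n → Bool

-- Oriented graph (digraph in the paper's sense): no loops, no antiparallel edges.
IsDigraph : {k : ℕ} → Rel k → Set
IsDigraph {k} E = ((x : Fin k) → E x x ≡ false)
                × ((x y : Fin k) → E x y ≡ true → E y x ≡ false)

IsTournament : {n : ℕ} → Rel n → Set
IsTournament {n} T = IsDigraph T
                   × ((x y : Fin n) → x ≢ y → (T x y ≡ true) ⊎ (T y x ≡ true))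

cons : {k n : ℕ} → Fin n → (Fin k → Fin n) → Fin (suc k) → Fin n
cons i f zero = i
cons i f (suc j) = f j

allMaps : (k n : ℕ) → List (Fin k → Fin n)
allMaps zero n = [ (λ ()) ]
allMaps (suc k) n = concatMap (λ i → map (cons i) (allMaps k n)) (allFin n)

allPairs : (k : ℕ) → List (Fin k × Fin k)
allPairs k = concatMap (λ x → map (λ y → (x , y)) (allFin k)) (allFin k)

allB : {A : Set} → (A → Bool) → List A → Bool
allB p = foldr (λ a b → p a ∧ b) true

isHom : {k n : ℕ} → Rel k → Rel n → (Fin k → Fin n) → Bool
isHom {k} D T φ = allB (λ p → not (D (Data.Product.proj₁ p) (Data.Product.proj₂ p))
                             ∨ T (φ (Data.Product.proj₁ p)) (φ (Data.Product.proj₂ p)))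
                      (allPairs k)

hom : {k n : ℕ} → Rel k → Rel n → ℕ
hom {k} {n} D T = length (filter (λ φ → isHom D T φ Data.Bool.≟ true) (allMaps k n))

edges : {k : ℕ} → Rel k → ℕ
edges {k} D = length (filter (λ p → D (Data.Product.proj₁ p) (Data.Product.proj₂ p) Data.Bool.≟ true) (allPairs k))

-- t_D(T) ≥ k^{-k}, where t_D(T) = h_D(T) / n^{v(D)}, cleared of denominators:
--   h_D(T) / n^k ≥ 1 / k^k   ⇔   n^k ≤ k^k * h_D(T)
DensityAtLeastInvPow : {k n : ℕ} → Rel k → Rel n → Set
DensityAtLeastInvPow {k} {n} D T = n ^ k ≤ k ^ k * hom D T

-- t_D(T) > 2^{-e(D)}, cleared of denominators:  n^k < 2^{e(D)} * h_D(T)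
DensityAbove2PowNegE : {k n : ℕ} → Rel k → Rel n → Set
DensityAbove2PowNegE {k} {n} D T = n ^ k < 2 ^ edges D * hom D T

-- D is tournament anti-Sidorenko: t_D(T) ≤ 2^{-e(D)} for every tournament T
-- (on any number n ≥ 1 of vertices), i.e. 2^{e(D)} * h_D(T) ≤ n^k.
TournamentAntiSidorenko : {k : ℕ} → Rel k → Set
TournamentAntiSidorenko {k} D =
  (n : ℕ) → 1 ≤ n → (T : Rel n) → IsTournament T → 2 ^ edges D * hom D T ≤ n ^ k

-- Blow up each vertex j of D into a class of m vertices (the residue class of j
-- in Fin (m * k)), orient the edges between classes as D does, and complete the
-- resulting oriented graph to a tournament T in any way. Every map sending each
-- vertex j of D into its own class is a homomorphism D → T, so
-- h_D(T) ≥ m ^ k = (m * k) ^ k / k ^ k. If moreover k ^ k < 2 ^ e(D), already the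
-- blow-up with m = 1 has density above 2 ^ -e(D).

module Submission where

open import Defs
open import Data.Nat using (ℕ; zero; suc; _+_; _*_; _^_; _≤_; _<_; z≤n; s≤s; NonZero; >-nonZero)
open import Data.Nat.Properties
  using (≤-trans; ≤-reflexive; ≤-<-trans; <⇒≱; m≤n+m; m≤n*m; +-mono-≤; *-monoˡ-≤; *-monoʳ-≤;
         *-monoˡ-<; *-comm; m^n>0; m*n≢0⇒m≢0; module ≤-Reasoning)
open import Data.Nat.Tactic.RingSolver using (solve-∀)
open import Data.Fin using (Fin; zero; suc; _↑ˡ_; _↑ʳ_; remainder; _≟_; _<?_)
open import Data.Fin.Properties using (splitAt-↑ʳ; remQuot-combine; <-irrefl; <-asym; <-cmp)
open import Data.Bool using (Bool; true; false; _∧_; _∨_; not)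
import Data.Bool as Bool
open import Data.List using (List; []; _∷_; _++_; map; concatMap; tabulate; allFin; filter; length)
open import Data.List.Properties using (filter-++; length-++; map-tabulate)
open import Data.List.Membership.Propositional using (_∈_)
open import Data.List.Membership.Propositional.Properties using (∈-filter⁺; ∈-tabulate⁺)
open import Data.List.Relation.Unary.Any using (here; there)
open import Data.List.Relation.Binary.Sublist.Propositional using (⊆-refl)
open import Data.List.Relation.Binary.Sublist.Propositional.Properties using (filter⁺; length-mono-≤)
open import Data.Product using (Σ; _×_; _,_; proj₂)
open import Data.Sum using (_⊎_; inj₁; inj₂)
open import Data.Empty using (⊥-elim)
open import Function using (_∘_)
open import Relation.Nullary using (¬_; yes; no)
open import Relation.Nullary.Decidable using (isYes; isYes≗does; dec-true)
open import Relation.Binary using (tri<; tri≈; tri>)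
open import Relation.Binary.PropositionalEquality using (_≡_; _≢_; refl; sym; trans; cong; subst₂)

count : {A : Set} → (A → Bool) → List A → ℕ
count P xs = length (filter (λ x → P x Bool.≟ true) xs)

module _ {A : Set} (P : A → Bool) where

  count-++ : (xs ys : List A) → count P (xs ++ ys) ≡ count P xs + count P ys
  count-++ xs ys = trans (cong length (filter-++ _ xs ys)) (length-++ (filter _ xs))

  count-map : {B : Set} (f : B → A) (xs : List B) → count P (map f xs) ≡ count (P ∘ f) xs
  count-map f [] = refl
  count-map f (x ∷ xs) with P (f x)
  ... | true  = cong suc (count-map f xs)
  ... | false = count-map f xs

  count-tabulate : ∀ {n} (f : Fin n → A) → count P (tabulate f) ≡ count (P ∘ f) (allFin n)
  count-tabulate f = trans (cong (count P) (sym (map-tabulate (λ x → x) f))) (count-map f (allFin _))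

  count-∈ : {x : A} {xs : List A} → x ∈ xs → P x ≡ true → 1 ≤ count P xs
  count-∈ x∈xs Px = nonEmpty (∈-filter⁺ (λ x → P x Bool.≟ true) x∈xs Px)
    where
    nonEmpty : {y : A} {ys : List A} → y ∈ ys → 1 ≤ length ys
    nonEmpty (here _)  = s≤s z≤n
    nonEmpty (there _) = s≤s z≤n

count-mono : {A : Set} {P Q : A → Bool} → (∀ x → P x ≡ true → Q x ≡ true) →
             (xs : List A) → count P xs ≤ count Q xs
count-mono P⇒Q xs = length-mono-≤ (filter⁺ _ _ (λ { refl → P⇒Q _ }) (⊆-refl {x = xs}))

count-concatMap-≥ : {A B : Set} (P : B → Bool) (Q : A → Bool) (g : A → List B) {b : ℕ} →
                    (∀ x → Q x ≡ true → b ≤ count P (g x)) →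
                    (xs : List A) → count Q xs * b ≤ count P (concatMap g xs)
count-concatMap-≥ P Q g h [] = z≤n
count-concatMap-≥ P Q g h (x ∷ xs) with Q x in Qx
... | true  = ≤-trans (+-mono-≤ (h x Qx) (count-concatMap-≥ P Q g h xs))
                      (≤-reflexive (sym (count-++ P (g x) (concatMap g xs))))
... | false = ≤-trans (≤-trans (count-concatMap-≥ P Q g h xs) (m≤n+m _ (count P (g x))))
                      (≤-reflexive (sym (count-++ P (g x) (concatMap g xs))))

allMaps-count-≥ : ∀ k {n c} (S : Fin k → Fin n → Bool) (P : (Fin k → Fin n) → Bool) →
                  (∀ j → c ≤ count (S j) (allFin n)) →
                  (∀ φ → (∀ j → S j (φ j) ≡ true) → P φ ≡ true) →
                  c ^ k ≤ count P (allMaps k n)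
allMaps-count-≥ zero S P _ S⇒P = count-∈ P (here refl) (S⇒P _ (λ ()))
allMaps-count-≥ (suc k) {n} {c} S P c≤S S⇒P =
  ≤-trans (*-monoˡ-≤ (c ^ k) (c≤S zero))
          (count-concatMap-≥ P (S zero) (λ i → map (cons i) (allMaps k n)) fibre (allFin n))
  where
  fibre : ∀ i → S zero i ≡ true → c ^ k ≤ count P (map (cons i) (allMaps k n))
  fibre i Si = ≤-trans
    (allMaps-count-≥ k (S ∘ suc) (P ∘ cons i) (c≤S ∘ suc)
       (λ ψ Sψ → S⇒P (cons i ψ) λ { zero → Si ; (suc j) → Sψ j }))
    (≤-reflexive (sym (count-map P (cons i) (allMaps k n))))

tabulate-++ : {A : Set} (m : ℕ) {n : ℕ} (f : Fin (m + n) → A) →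
              tabulate f ≡ tabulate (f ∘ (_↑ˡ n)) ++ tabulate (f ∘ (m ↑ʳ_))
tabulate-++ zero    f = refl
tabulate-++ (suc m) f = cong (f zero ∷_) (tabulate-++ m (f ∘ suc))

remainder-↑ʳ : ∀ {m} k (i : Fin (m * k)) → remainder {suc m} k (k ↑ʳ i) ≡ remainder {m} k i
remainder-↑ʳ {m} k i rewrite splitAt-↑ʳ k (m * k) i = refl

inFibre : ∀ {m k} → Fin k → Fin (m * k) → Bool
inFibre {m} {k} j x = isYes (remainder {m} k x ≟ j)

inFibre-count : ∀ m {k} (j : Fin k) → m ≤ count (inFibre {m} j) (allFin (m * k))
inFibre-count zero        j = z≤n
inFibre-count (suc m) {k} j = begin
  1 + m
    ≤⟨ +-mono-≤ firstBlock otherBlocks ⟩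
  count P (tabulate (_↑ˡ (m * k))) + count P (tabulate (k ↑ʳ_))
    ≡⟨ sym (count-++ P (tabulate (_↑ˡ (m * k))) _) ⟩
  count P (tabulate (_↑ˡ (m * k)) ++ tabulate (k ↑ʳ_))
    ≡⟨ cong (count P) (sym (tabulate-++ k (λ x → x))) ⟩
  count P (allFin (suc m * k)) ∎
  where
  open ≤-Reasoning
  P : Fin (suc m * k) → Bool
  P = inFibre {suc m} j
  firstBlock : 1 ≤ count P (tabulate (_↑ˡ (m * k)))
  firstBlock = count-∈ P (∈-tabulate⁺ j) (trans (isYes≗does (_ ≟ j)) (dec-true (_ ≟ j) jᵣ≡j))
    where
    jᵣ≡j : remainder {suc m} k (j ↑ˡ (m * k)) ≡ j
    jᵣ≡j = cong proj₂ (remQuot-combine zero j)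
  otherBlocks : m ≤ count P (tabulate (k ↑ʳ_))
  otherBlocks = begin
    m                                         ≤⟨ inFibre-count m j ⟩
    count (inFibre {m} j) (allFin (m * k))    ≤⟨ count-mono shift (allFin (m * k)) ⟩
    count (P ∘ (k ↑ʳ_)) (allFin (m * k))      ≡⟨ sym (count-tabulate P (k ↑ʳ_)) ⟩
    count P (tabulate (k ↑ʳ_))                ∎
    where
    shift : ∀ i → inFibre {m} j i ≡ true → P (k ↑ʳ i) ≡ true
    shift i = trans (cong (λ r → isYes (r ≟ j)) (remainder-↑ʳ k i))

completion : ∀ {n} → Rel n → Rel n
completion E x y = E x y ∨ (not (E y x) ∧ isYes (x <? y))

completion-⊇ : ∀ {n} {E : Rel n} {x y} → E x y ≡ true → completion E x y ≡ true
completion-⊇ Exy rewrite Exy = refl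

completion-isTournament : ∀ {n} {E : Rel n} → IsDigraph E → IsTournament (completion E)
completion-isTournament {E = E} (irreflexive , antisymmetric) = (loopless , oriented) , total
  where
  loopless : ∀ x → completion E x x ≡ false
  loopless x rewrite irreflexive x with x <? x
  ... | yes x<x = ⊥-elim (<-irrefl refl x<x)
  ... | no _    = refl

  oriented : ∀ x y → completion E x y ≡ true → completion E y x ≡ false
  oriented x y h with E x y in Exy | E y x in Eyx
  ... | true  | true  with () ← trans (sym (antisymmetric x y Exy)) Eyx
  ... | true  | false = refl
  ... | false | true  with () ← h
  ... | false | false with x <? y | y <? x
  ...   | yes x<y | yes y<x = ⊥-elim (<-asym x<y y<x)
  ...   | yes _   | no _    = refl

  total : ∀ x y → x ≢ y → completion E x y ≡ true ⊎ completion E y x ≡ true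
  total x y x≢y with E x y | E y x
  ... | true  | _     = inj₁ refl
  ... | false | true  = inj₂ refl
  ... | false | false with <-cmp x y
  ...   | tri≈ _ x≡y _ = ⊥-elim (x≢y x≡y)
  ...   | tri< x<y _ _ with x <? y
  ...     | yes _   = inj₁ refl
  ...     | no x≮y  = ⊥-elim (x≮y x<y)
  total x y x≢y | false | false | tri> _ _ y<x with y <? x
  ...     | yes _   = inj₂ refl
  ...     | no y≮x  = ⊥-elim (y≮x y<x)

pullback : ∀ {n k} → (Fin n → Fin k) → Rel k → Rel n
pullback f E x y = E (f x) (f y)

pullback-isDigraph : ∀ {n k} (f : Fin n → Fin k) {E : Rel k} →
                     IsDigraph E → IsDigraph (pullback f E)
pullback-isDigraph f (irreflexive , antisymmetric) =
  (λ x → irreflexive (f x)) , (λ x y → antisymmetric (f x) (f y))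

allB-true : {A : Set} (p : A → Bool) → (∀ a → p a ≡ true) → (xs : List A) → allB p xs ≡ true
allB-true p h []       = refl
allB-true p h (x ∷ xs) rewrite h x = allB-true p h xs

isHom-intro : ∀ {k n} {D : Rel k} {T : Rel n} (φ : Fin k → Fin n) →
              (∀ x y → D x y ≡ true → T (φ x) (φ y) ≡ true) → isHom D T φ ≡ true
isHom-intro {k} {D = D} {T} φ preserves = allB-true _ edgeOK (allPairs k)
  where
  edgeOK : ((x , y) : Fin k × Fin k) → not (D x y) ∨ T (φ x) (φ y) ≡ true
  edgeOK (x , y) with D x y in Dxy
  ... | false = refl
  ... | true  = preserves x y Dxy

blowUp : ∀ {k} → Rel k → (m : ℕ) → Rel (m * k)
blowUp {k} D m = completion (pullback (remainder {m} k) D)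

blowUp-isTournament : ∀ {k} {D : Rel k} → IsDigraph D → (m : ℕ) → IsTournament (blowUp D m)
blowUp-isTournament {k} dg m = completion-isTournament (pullback-isDigraph (remainder {m} k) dg)

blowUp-hom-≥ : ∀ {k} (D : Rel k) (m : ℕ) → m ^ k ≤ hom D (blowUp D m)
blowUp-hom-≥ {k} D m =
  allMaps-count-≥ k (inFibre {m}) (isHom D (blowUp D m)) (inFibre-count m) section⇒hom
  where
  section⇒hom : ∀ φ → (∀ j → inFibre {m} j (φ j) ≡ true) → isHom D (blowUp D m) φ ≡ true
  section⇒hom φ φ∈fibres = isHom-intro {T = blowUp D m} φ λ x y Dxy →
    completion-⊇ {E = pullback (remainder {m} k) D}
      (subst₂ (λ u v → D u v ≡ true) (sym (fibre x)) (sym (fibre y)) Dxy)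
    where
    fibre : ∀ j → remainder {m} k (φ j) ≡ j
    fibre j with remainder {m} k (φ j) ≟ j | φ∈fibres j
    ... | yes r≡j | _ = r≡j

^-distribʳ-* : ∀ m n o → (m * n) ^ o ≡ m ^ o * n ^ o
^-distribʳ-* m n zero    = refl
^-distribʳ-* m n (suc o) rewrite ^-distribʳ-* m n o = interchange m n (m ^ o) (n ^ o)
  where
  interchange : ∀ a b c d → a * b * (c * d) ≡ a * c * (b * d)
  interchange = solve-∀

blowUp-density : ∀ {k} (D : Rel k) (m : ℕ) → DensityAtLeastInvPow D (blowUp D m)
blowUp-density {k} D m = begin
  (m * k) ^ k      ≡⟨ ^-distribʳ-* m k k ⟩
  m ^ k * k ^ k    ≡⟨ *-comm (m ^ k) (k ^ k) ⟩
  k ^ k * m ^ k    ≤⟨ *-monoʳ-≤ (k ^ k) (blowUp-hom-≥ D m) ⟩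
  k ^ k * hom D (blowUp D m) ∎
  where open ≤-Reasoning

blowUp-density-above : ∀ {k} (D : Rel k) (m : ℕ) .{{_ : NonZero m}} →
                       k ^ k < 2 ^ edges D → DensityAbove2PowNegE D (blowUp D m)
blowUp-density-above {k} D m kᵏ<2ᵉ =
  ≤-<-trans (blowUp-density D m) (*-monoˡ-< (hom D (blowUp D m)) {{>-nonZero hom>0}} kᵏ<2ᵉ)
  where
  hom>0 : 0 < hom D (blowUp D m)
  hom>0 = ≤-trans (m^n>0 m k) (blowUp-hom-≥ D m)

dense⇒¬antiSidorenko : ∀ {k n} (D : Rel k) (T : Rel n) → 1 ≤ n → IsTournament T →
                       DensityAbove2PowNegE D T → ¬ TournamentAntiSidorenko D
dense⇒¬antiSidorenko {n = n} D T 1≤n tournament dense antiSidorenko =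
  <⇒≱ dense (antiSidorenko n 1≤n T tournament)

-- For k = 0 the hypothesis reads 1 < 1.
kᵏ<2ᵉ⇒k>0 : ∀ {k} (D : Rel k) → k ^ k < 2 ^ edges D → 1 ≤ k
kᵏ<2ᵉ⇒k>0 {zero}  D (s≤s ())
kᵏ<2ᵉ⇒k>0 {suc k} D _ = s≤s z≤n

lemma3p1 : (k : ℕ) (D : Rel k) → IsDigraph D →
    ((m : ℕ) → 1 ≤ m * k →
      Σ (Rel (m * k)) (λ T → IsTournament T × DensityAtLeastInvPow D T))
    × (k ^ k < 2 ^ edges D →
      ((m : ℕ) → 1 ≤ m * k →
        Σ (Rel (m * k)) (λ T → IsTournament T × DensityAtLeastInvPow D T × DensityAbove2PowNegE D T))
      × ¬ TournamentAntiSidorenko D)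
lemma3p1 k D dg = dense , λ kᵏ<2ᵉ → denseAbove kᵏ<2ᵉ , notAntiSidorenko kᵏ<2ᵉ
  where
  dense : (m : ℕ) → 1 ≤ m * k → Σ (Rel (m * k)) (λ T → IsTournament T × DensityAtLeastInvPow D T)
  dense m _ = blowUp D m , blowUp-isTournament dg m , blowUp-density D m

  denseAbove : k ^ k < 2 ^ edges D → (m : ℕ) → 1 ≤ m * k →
    Σ (Rel (m * k)) (λ T → IsTournament T × DensityAtLeastInvPow D T × DensityAbove2PowNegE D T)
  denseAbove kᵏ<2ᵉ m 1≤mk =
    blowUp D m , blowUp-isTournament dg m , blowUp-density D m ,
    blowUp-density-above D m {{m*n≢0⇒m≢0 m {{>-nonZero 1≤mk}}}} kᵏ<2ᵉ

  notAntiSidorenko : k ^ k < 2 ^ edges D → ¬ TournamentAntiSidorenko D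
  notAntiSidorenko kᵏ<2ᵉ =
    dense⇒¬antiSidorenko D (blowUp D 1) (≤-trans (kᵏ<2ᵉ⇒k>0 D kᵏ<2ᵉ) (m≤n*m k 1))
      (blowUp-isTournament dg 1) (blowUp-density-above D 1 kᵏ<2ᵉ)
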